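{- Let $D$ be a point-determining digraph, and let $T_1$ and $T_2$ be two triples of $D$. If $T_1$ and $T_2$ intersect in a vertex that is green in $T_1$ and red in $T_2$, then they intersect in another vertex that is green in $T_2$ and red in $T_1$.
   Context: Digraphs are finite, without loops and multiple arcs. For distinct vertices $u,v,w$ of a digraph $D$, $w$ distinguishes $u,v$ if exactly one of $u,v$ is an in-neighbour of $w$, or exactly one of $u,v$ is an out-neighbour of $w$. Distinct vertices $u,v$ are twins in $D$ if no vertex of $D$ distinguishes them; false twins if moreover neither $(u,v)$ nor $(v,u)$ is an arc. $D$ is point-determining if it has no pair of false twins. A triple $T=(x,\{y,z\})$ of a point-determining digraph $D$ consists of a vertex $x$ (the red vertex of $T$) and an unordered pair $\{y,z\}$ of distinct vertices other than $x$ (the green vertices of $T$) such that $y,z$ are false twins in $D-x$ (so $x$ is the only vertex of $D$ distinguishing $y$ and $z$). -}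

module Defs where

open import Data.Nat using (ℕ)
open import Data.Fin using (Fin)
open import Data.Bool using (Bool; false)
open import Data.Product using (_×_)
open import Data.Sum using (_⊎_)
open import Relation.Nullary using (¬_)
open import Relation.Binary.PropositionalEquality using (_≡_; _≢_)

record Digraph (n : ℕ) : Set where
  field
    arc      : Fin n → Fin n → Bool
    loopless : ∀ v → arc v v ≡ false
open Digraph public

Distinguishes : ∀ {n} → Digraph n → Fin n → Fin n → Fin n → Set
Distinguishes D w u v =
  w ≢ u × w ≢ v × u ≢ v ×
  (arc D u w ≢ arc D v w ⊎ arc D w u ≢ arc D w v)

-- False twins in the induced subdigraph of D on the vertex set
-- {w | Present w}: u,v are distinct present vertices, no present vertex
-- distinguishes them, and neither (u,v) nor (v,u) is an arc.
FalseTwinsIn : ∀ {n} → Digraph n → (Fin n → Set) → Fin n → Fin n → Set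
FalseTwinsIn D Present u v =
  Present u × Present v × u ≢ v ×
  (∀ w → Present w → ¬ Distinguishes D w u v) ×
  arc D u v ≡ false × arc D v u ≡ false

FalseTwins : ∀ {n} → Digraph n → Fin n → Fin n → Set
FalseTwins D u v = FalseTwinsIn D (λ _ → ⊤') u v
  where
  open import Data.Unit using () renaming (⊤ to ⊤')

FalseTwinsMinus : ∀ {n} → Digraph n → Fin n → Fin n → Fin n → Set
FalseTwinsMinus D x u v = FalseTwinsIn D (λ w → w ≢ x) u v

PointDetermining : ∀ {n} → Digraph n → Set
PointDetermining D = ∀ u v → ¬ FalseTwins D u v

record Triple {n : ℕ} (D : Digraph n) : Set where
  field
    red    : Fin n
    green₁ : Fin n
    green₂ : Fin n
    twins  : FalseTwinsMinus D red green₁ green₂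
open Triple public

IsGreen : ∀ {n} {D : Digraph n} → Triple D → Fin n → Set
IsGreen T v = v ≡ green₁ T ⊎ v ≡ green₂ T

-- Let T₁ = (x, {y, z}) and T₂ = (y, {a, b}), and suppose x ∉ {a, b}. Then a, b
-- are false twins of D - y, and y does not distinguish them either: every vertex
-- outside {x, y, z} sees y and z alike, so y sees a and b as z does, and z does
-- not distinguish them in D - y; if instead z ∈ {a, b}, the non-adjacency of
-- the twins y, z and of the twins a, b does the job. Hence a, b are false twins
-- of D, against point-determinacy.
module Submission where

open import Defs
open import Data.Nat using (ℕ)
open import Data.Fin using (Fin)
open import Data.Fin.Properties using () renaming (_≟_ to _≟ᶠ_)
open import Data.Bool using (false)
open import Data.Bool.Properties using () renaming (_≟_ to _≟ᵇ_)
open import Data.Product using (_×_; _,_; ∃)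
open import Data.Sum using (_⊎_; inj₁; inj₂)
open import Data.Empty using (⊥-elim)
open import Data.Unit using (tt)
open import Function using (_∘_)
open import Relation.Nullary using (¬_; yes; no)
open import Relation.Binary.PropositionalEquality
  using (_≡_; _≢_; refl; sym; ≢-sym; module ≡-Reasoning)

module _ {n : ℕ} (D : Digraph n) where

  open ≡-Reasoning

  Agrees : Fin n → Fin n → Fin n → Set
  Agrees w u v = arc D u w ≡ arc D v w × arc D w u ≡ arc D w v

  agrees-sym : ∀ {w u v} → Agrees w u v → Agrees w v u
  agrees-sym (in≡ , out≡) = sym in≡ , sym out≡

  agrees⇒¬distinguishes : ∀ {w u v} → Agrees w u v → ¬ Distinguishes D w u v
  agrees⇒¬distinguishes (in≡ , _) (_ , _ , _ , inj₁ in≢) = in≢ in≡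
  agrees⇒¬distinguishes (_ , out≡) (_ , _ , _ , inj₂ out≢) = out≢ out≡

  ¬distinguishes⇒agrees : ∀ {w u v} → w ≢ u → w ≢ v → u ≢ v →
                          ¬ Distinguishes D w u v → Agrees w u v
  ¬distinguishes⇒agrees {w} {u} {v} w≢u w≢v u≢v ¬dist
    with arc D u w ≟ᵇ arc D v w | arc D w u ≟ᵇ arc D w v
  ... | yes in≡ | yes out≡ = in≡ , out≡
  ... | no in≢  | _        = ⊥-elim (¬dist (w≢u , w≢v , u≢v , inj₁ in≢))
  ... | yes _   | no out≢  = ⊥-elim (¬dist (w≢u , w≢v , u≢v , inj₂ out≢))

  distinguishes-sym : ∀ {w u v} → Distinguishes D w u v → Distinguishes D w v u
  distinguishes-sym (w≢u , w≢v , u≢v , inj₁ in≢) =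
    w≢v , w≢u , ≢-sym u≢v , inj₁ (≢-sym in≢)
  distinguishes-sym (w≢u , w≢v , u≢v , inj₂ out≢) =
    w≢v , w≢u , ≢-sym u≢v , inj₂ (≢-sym out≢)

  falseTwinsIn-sym : ∀ {P u v} → FalseTwinsIn D P u v → FalseTwinsIn D P v u
  falseTwinsIn-sym (Pu , Pv , u≢v , ¬dist , uv , vu) =
    Pv , Pu , ≢-sym u≢v , (λ w Pw → ¬dist w Pw ∘ distinguishes-sym) , vu , uv

  falseTwinsIn⇒agrees : ∀ {P u v} → FalseTwinsIn D P u v →
                        ∀ {w} → P w → w ≢ u → w ≢ v → Agrees w u v
  falseTwinsIn⇒agrees (_ , _ , u≢v , ¬dist , _) {w} Pw w≢u w≢v =
    ¬distinguishes⇒agrees w≢u w≢v u≢v (¬dist w Pw)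

  falseTwinsMinus⇒falseTwins : ∀ {y a b} → FalseTwinsMinus D y a b →
                               Agrees y a b → FalseTwins D a b
  falseTwinsMinus⇒falseTwins {y} {a} {b} (_ , _ , a≢b , ¬dist , ab , ba) y-agrees =
    tt , tt , a≢b , (λ w _ → ¬distinguishedBy w) , ab , ba
    where
    ¬distinguishedBy : ∀ w → ¬ Distinguishes D w a b
    ¬distinguishedBy w with w ≟ᶠ y
    ... | yes refl = agrees⇒¬distinguishes y-agrees
    ... | no w≢y   = ¬dist w w≢y

  red-agrees-on-green-twin : ∀ {x y z b} → FalseTwinsMinus D x y z →
                             FalseTwinsMinus D y z b → b ≢ x → Agrees y z b
  red-agrees-on-green-twin {y = y} {z} {b} t₁@(_ , _ , _ , _ , yz , zy)
                           (_ , b≢y , z≢b , _ , zb , bz) b≢x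
    with falseTwinsIn⇒agrees t₁ b≢x b≢y (≢-sym z≢b)
  ... | yb≡zb , by≡bz =
    (begin arc D z y ≡⟨ zy ⟩
           false     ≡⟨ sym bz ⟩
           arc D b z ≡⟨ sym by≡bz ⟩
           arc D b y ∎) ,
    (begin arc D y z ≡⟨ yz ⟩
           false     ≡⟨ sym zb ⟩
           arc D z b ≡⟨ sym yb≡zb ⟩
           arc D y b ∎)

  red-agrees-on-twins : ∀ {x y z a b} → FalseTwinsMinus D x y z →
                        FalseTwinsMinus D y a b → a ≢ x → b ≢ x → Agrees y a b
  red-agrees-on-twins {y = y} {z} {a} {b} t₁@(_ , _ , y≢z , _) t₂@(a≢y , b≢y , _)
                      a≢x b≢x
    with z ≟ᶠ a | z ≟ᶠ b
  ... | yes refl | _        = red-agrees-on-green-twin t₁ t₂ b≢x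
  ... | no _     | yes refl =
    agrees-sym (red-agrees-on-green-twin t₁ (falseTwinsIn-sym t₂) a≢x)
  ... | no z≢a   | no z≢b
    with falseTwinsIn⇒agrees t₁ a≢x a≢y (≢-sym z≢a)
       | falseTwinsIn⇒agrees t₁ b≢x b≢y (≢-sym z≢b)
       | falseTwinsIn⇒agrees t₂ (≢-sym y≢z) z≢a z≢b
  ... | ya≡za , ay≡az | yb≡zb , by≡bz | az≡bz , za≡zb =
    (begin arc D a y ≡⟨ ay≡az ⟩
           arc D a z ≡⟨ az≡bz ⟩
           arc D b z ≡⟨ sym by≡bz ⟩
           arc D b y ∎) ,
    (begin arc D y a ≡⟨ ya≡za ⟩
           arc D z a ≡⟨ za≡zb ⟩
           arc D z b ≡⟨ sym yb≡zb ⟩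
           arc D y b ∎)

  red-is-green-of-twin : PointDetermining D → ∀ {x y z a b} →
                         FalseTwinsMinus D x y z → FalseTwinsMinus D y a b →
                         x ≡ a ⊎ x ≡ b
  red-is-green-of-twin pd {x} {a = a} {b} t₁ t₂ with x ≟ᶠ a | x ≟ᶠ b
  ... | yes x≡a | _        = inj₁ x≡a
  ... | no _    | yes x≡b  = inj₂ x≡b
  ... | no x≢a  | no x≢b   = ⊥-elim (pd a b (falseTwinsMinus⇒falseTwins t₂
                               (red-agrees-on-twins t₁ t₂ (≢-sym x≢a) (≢-sym x≢b))))

  green⇒falseTwin : (T : Triple D) → ∀ {v} → IsGreen T v →
                    ∃ λ w → FalseTwinsMinus D (red T) v w
  green⇒falseTwin T (inj₁ refl) = green₂ T , twins T
  green⇒falseTwin T (inj₂ refl) = green₁ T , falseTwinsIn-sym (twins T)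

lemma1 : ∀ {n} (D : Digraph n) → PointDetermining D →
    (T₁ T₂ : Triple D) (v : Fin n) →
    IsGreen T₁ v → v ≡ red T₂ →
    (red T₁ ≢ v) × IsGreen T₂ (red T₁)
lemma1 D pd T₁ T₂ v v-green refl with green⇒falseTwin D T₁ v-green
... | _ , t@(v≢red , _) = ≢-sym v≢red , red-is-green-of-twin D pd t (twins T₂)
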